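{- Let $a$ be any positive integer and $b$ a positive integer. (1) If $b\equiv 1,2,8$ or $19\pmod{20}$, then $S(n)=F_{5an+b}$ is an LP function with the prime $5$. (2) If $b\equiv 1\pmod 4$, then $S(n)=L_{an+b}$ is an LP function with the prime $5$.
   Context: $F_n$ is the Fibonacci sequence ($F_0=0$, $F_1=1$, $F_n=F_{n-1}+F_{n-2}$) and $L_n$ the Lucas numbers ($L_0=2$, $L_1=1$, $L_n=L_{n-1}+L_{n-2}$). An arithmetic function $S$ is an LP function with the prime $p$ if for every nonnegative integer $n=\sum_{i=0}^{r}n_i p^i$ with base-$p$ digits $0\le n_i\le p-1$, one has $S(n)\equiv S(n_0)S(n_1)\cdots S(n_r)\pmod p$. -}

module Defs where

open import Data.Nat using (ℕ; zero; suc; _+_; _*_; _<_; _<?_; NonZero)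
open import Data.Nat.DivMod using (_/_; _%_)
open import Data.List using (List; []; _∷_; map)
open import Data.Nat.ListAction using (product)
open import Relation.Binary.PropositionalEquality using (_≡_)
open import Relation.Nullary using (yes; no)

fib : ℕ → ℕ
fib zero = 0
fib (suc zero) = 1
fib (suc (suc n)) = fib (suc n) + fib n

lucas : ℕ → ℕ
lucas zero = 2
lucas (suc zero) = 1
lucas (suc (suc n)) = lucas (suc n) + lucas n

digitsFuel : (p : ℕ) → .{{_ : NonZero p}} → ℕ → ℕ → List ℕ
digitsFuel p zero n = n ∷ []
digitsFuel p (suc k) n with n <? p
... | yes _ = n ∷ []
... | no _ = (n % p) ∷ digitsFuel p k (n / p)

-- fuel n suffices for p ≥ 2 (n / p < n whenever n ≥ p ≥ 2)
digits : (p : ℕ) → .{{_ : NonZero p}} → ℕ → List ℕ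
digits p n = digitsFuel p n n

IsLP : (p : ℕ) → .{{_ : NonZero p}} → (ℕ → ℕ) → Set
IsLP p S = ∀ n → S n % p ≡ product (map S (digits p n)) % p

-- Modulo 5 the characteristic polynomial x² − x − 1 of both recurrences is (x − 3)², so
-- F_{k+5} ≡ 3 F_k and L_n ≡ 2 · 3^n. Since 3^4 ≡ 1, the residue conditions on b give
-- F_b ≡ L_b ≡ 1, and both sequences become S(n) ≡ g^n with g = 3^a. Such an S is LP for
-- the prime 5 because g^5 ≡ g: writing n = n₀ + 5m gives g^n ≡ g^{n₀} g^m, and induction on
-- the digits does the rest.
module Submission where

open import Defs
open import Data.Nat using (ℕ; zero; suc; _+_; _*_; _^_; _≤_; _<?_; NonZero)
open import Data.Nat.DivMod using (_%_; _/_; %-distribˡ-+; %-distribˡ-*; [m+kn]%n≡m%n; m≡m%n+[m/n]*n)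
open import Data.Nat.Properties using (+-identityʳ; +-assoc; *-comm; *-assoc; *-identityʳ; ^-distribˡ-+-*; ^-*-assoc; ^-zeroˡ; *-commutativeSemigroup)
open import Data.Nat.Tactic.RingSolver using (solve-∀)
open import Algebra.Properties.CommutativeSemigroup *-commutativeSemigroup using (x∙yz≈y∙xz)
open import Data.Nat.ListAction using (product)
open import Data.List using (map)
open import Data.Product using (_×_; _,_)
open import Data.Sum using (_⊎_; inj₁; inj₂)
open import Relation.Binary.Bundles using (Setoid)
open import Relation.Binary.PropositionalEquality as ≡ using (_≡_; refl; cong; cong₂)
open import Relation.Nullary using (yes; no)

module Congruence (p : ℕ) .{{_ : NonZero p}} where

  infix 4 _≈_
  record _≈_ (x y : ℕ) : Set where
    constructor mod-p
    field %-≡ : x % p ≡ y % p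
  open _≈_ public

  ≈-refl : ∀ {x} → x ≈ x
  ≈-refl = mod-p refl

  ≈-sym : ∀ {x y} → x ≈ y → y ≈ x
  ≈-sym (mod-p e) = mod-p (≡.sym e)

  ≈-trans : ∀ {x y z} → x ≈ y → y ≈ z → x ≈ z
  ≈-trans (mod-p e) (mod-p f) = mod-p (≡.trans e f)

  ≈-setoid : Setoid _ _
  ≈-setoid = record
    { _≈_           = _≈_
    ; isEquivalence = record { refl = ≈-refl ; sym = ≈-sym ; trans = ≈-trans }
    }

  ≡⇒≈ : ∀ {x y} → x ≡ y → x ≈ y
  ≡⇒≈ refl = ≈-refl

  +-*p-≈ : ∀ x k → x + k * p ≈ x
  +-*p-≈ x k = mod-p ([m+kn]%n≡m%n x k p)

  +-cong : ∀ {x y u v} → x ≈ y → u ≈ v → x + u ≈ y + v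
  +-cong {x} {y} {u} {v} (mod-p x≈y) (mod-p u≈v) = mod-p (begin
    (x + u) % p               ≡⟨ %-distribˡ-+ x u p ⟩
    (x % p + u % p) % p       ≡⟨ cong₂ (λ s t → (s + t) % p) x≈y u≈v ⟩
    (y % p + v % p) % p       ≡⟨ ≡.sym (%-distribˡ-+ y v p) ⟩
    (y + v) % p               ∎)
    where open ≡.≡-Reasoning

  *-cong : ∀ {x y u v} → x ≈ y → u ≈ v → x * u ≈ y * v
  *-cong {x} {y} {u} {v} (mod-p x≈y) (mod-p u≈v) = mod-p (begin
    (x * u) % p               ≡⟨ %-distribˡ-* x u p ⟩
    (x % p * (u % p)) % p     ≡⟨ cong₂ (λ s t → (s * t) % p) x≈y u≈v ⟩
    (y % p * (v % p)) % p     ≡⟨ ≡.sym (%-distribˡ-* y v p) ⟩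
    (y * v) % p               ∎)
    where open ≡.≡-Reasoning

  *-congˡ : ∀ x {u v} → u ≈ v → x * u ≈ x * v
  *-congˡ x = *-cong (≈-refl {x})

  ^-congˡ : ∀ {x y} → x ≈ y → ∀ n → x ^ n ≈ y ^ n
  ^-congˡ x≈y zero    = ≈-refl
  ^-congˡ x≈y (suc n) = *-cong x≈y (^-congˡ x≈y n)

  open import Relation.Binary.Reasoning.Setoid ≈-setoid

  ^≈^%*^/ : ∀ {g} → g ^ p ≈ g → ∀ n → g ^ n ≈ g ^ (n % p) * g ^ (n / p)
  ^≈^%*^/ {g} gᵖ≈g n = begin
    g ^ n                              ≡⟨ cong (g ^_) n≡r+p*q ⟩
    g ^ (n % p + p * (n / p))          ≡⟨ ^-distribˡ-+-* g (n % p) (p * (n / p)) ⟩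
    g ^ (n % p) * g ^ (p * (n / p))    ≡⟨ cong (g ^ (n % p) *_) (≡.sym (^-*-assoc g p (n / p))) ⟩
    g ^ (n % p) * (g ^ p) ^ (n / p)    ≈⟨ *-congˡ (g ^ (n % p)) (^-congˡ gᵖ≈g (n / p)) ⟩
    g ^ (n % p) * g ^ (n / p)          ∎
    where
    n≡r+p*q : n ≡ n % p + p * (n / p)
    n≡r+p*q = ≡.trans (m≡m%n+[m/n]*n n p) (cong (n % p +_) (*-comm (n / p) p))

  -- The fuel is irrelevant: when it runs out, the last "digit" is the whole remaining number.
  product-digitsFuel≈^ : ∀ {g} {S : ℕ → ℕ} → g ^ p ≈ g → (∀ n → S n ≈ g ^ n) →
                         ∀ k n → product (map S (digitsFuel p k n)) ≈ g ^ n
  product-digitsFuel≈^ {S = S} gᵖ≈g S≈gⁿ zero n = ≈-trans (≡⇒≈ (*-identityʳ (S n))) (S≈gⁿ n)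
  product-digitsFuel≈^ {S = S} gᵖ≈g S≈gⁿ (suc k) n with n <? p
  ... | yes _ = ≈-trans (≡⇒≈ (*-identityʳ (S n))) (S≈gⁿ n)
  ... | no _  = ≈-trans (*-cong (S≈gⁿ (n % p)) (product-digitsFuel≈^ gᵖ≈g S≈gⁿ k (n / p)))
                        (≈-sym (^≈^%*^/ gᵖ≈g n))

  isLP-geometric : ∀ {g} {S : ℕ → ℕ} → g ^ p ≈ g → (∀ n → S n ≈ g ^ n) → IsLP p S
  isLP-geometric gᵖ≈g S≈gⁿ n = %-≡ (≈-trans (S≈gⁿ n) (≈-sym (product-digitsFuel≈^ gᵖ≈g S≈gⁿ n n)))

open Congruence 5
open import Relation.Binary.Reasoning.Setoid ≈-setoid

3^[4*m]≈1 : ∀ m → 3 ^ (4 * m) ≈ 1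
3^[4*m]≈1 m = begin
  3 ^ (4 * m)     ≡⟨ ≡.sym (^-*-assoc 3 4 m) ⟩
  81 ^ m          ≈⟨ ^-congˡ (mod-p refl) m ⟩
  1 ^ m           ≡⟨ ^-zeroˡ m ⟩
  1               ∎

[3^a]^5≈3^a : ∀ a → (3 ^ a) ^ 5 ≈ 3 ^ a
[3^a]^5≈3^a a = begin
  (3 ^ a) ^ 5     ≡⟨ ^-*-assoc 3 a 5 ⟩
  3 ^ (a * 5)     ≡⟨ cong (3 ^_) (*-comm a 5) ⟩
  3 ^ (5 * a)     ≡⟨ ≡.sym (^-*-assoc 3 5 a) ⟩
  243 ^ a         ≈⟨ ^-congˡ (mod-p refl) a ⟩
  3 ^ a           ∎

fib-5+ : ∀ k → fib (5 + k) ≡ 3 * fib k + fib (suc k) * 5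
fib-5+ k = expand (fib (suc k)) (fib k)
  where
  expand : ∀ x y → x + y + x + (x + y) + (x + y + x) ≡ 3 * y + x * 5
  expand = solve-∀

fib-*5+ : ∀ m c → fib (m * 5 + c) ≈ 3 ^ m * fib c
fib-*5+ zero    c = ≡⇒≈ (≡.sym (+-identityʳ (fib c)))
fib-*5+ (suc m) c = begin
  fib (5 + m * 5 + c)                               ≡⟨ cong fib (+-assoc 5 (m * 5) c) ⟩
  fib (5 + (m * 5 + c))                             ≡⟨ fib-5+ (m * 5 + c) ⟩
  3 * fib (m * 5 + c) + fib (suc (m * 5 + c)) * 5   ≈⟨ +-*p-≈ _ (fib (suc (m * 5 + c))) ⟩
  3 * fib (m * 5 + c)                               ≈⟨ *-congˡ 3 (fib-*5+ m c) ⟩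
  3 * (3 ^ m * fib c)                               ≡⟨ ≡.sym (*-assoc 3 (3 ^ m) (fib c)) ⟩
  3 ^ suc m * fib c                                 ∎

fib-residue≈1 : ∀ {r} → (r ≡ 1 ⊎ r ≡ 2 ⊎ r ≡ 8 ⊎ r ≡ 19) → fib r ≈ 1
fib-residue≈1 (inj₁ refl)                 = ≈-refl
fib-residue≈1 (inj₂ (inj₁ refl))          = ≈-refl
fib-residue≈1 (inj₂ (inj₂ (inj₁ refl)))   = mod-p refl
fib-residue≈1 (inj₂ (inj₂ (inj₂ refl)))   = mod-p refl

fib≈1 : ∀ b → (b % 20 ≡ 1 ⊎ b % 20 ≡ 2 ⊎ b % 20 ≡ 8 ⊎ b % 20 ≡ 19) → fib b ≈ 1
fib≈1 b b%20∈R = begin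
  fib b                          ≡⟨ cong fib b≡4q*5+r ⟩
  fib (4 * q * 5 + r)            ≈⟨ fib-*5+ (4 * q) r ⟩
  3 ^ (4 * q) * fib r            ≈⟨ *-cong (3^[4*m]≈1 q) (fib-residue≈1 b%20∈R) ⟩
  1                              ∎
  where
  q = b / 20
  r = b % 20
  regroup : ∀ r q → r + q * 20 ≡ 4 * q * 5 + r
  regroup = solve-∀
  b≡4q*5+r : b ≡ 4 * q * 5 + r
  b≡4q*5+r = ≡.trans (m≡m%n+[m/n]*n b 20) (regroup r q)

lucas≈2*3^ : ∀ n → lucas n ≈ 2 * 3 ^ n
lucas≈2*3^ zero          = ≈-refl
lucas≈2*3^ (suc zero)    = mod-p refl
lucas≈2*3^ (suc (suc n)) = begin
  lucas (suc n) + lucas n                    ≈⟨ +-cong (lucas≈2*3^ (suc n)) (lucas≈2*3^ n) ⟩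
  2 * 3 ^ suc n + 2 * 3 ^ n                  ≈⟨ ≈-sym (+-*p-≈ _ (2 * 3 ^ n)) ⟩
  2 * 3 ^ suc n + 2 * 3 ^ n + 2 * 3 ^ n * 5  ≡⟨ regroup (3 ^ n) ⟩
  2 * 3 ^ suc (suc n)                        ∎
  where
  regroup : ∀ t → 2 * (3 * t) + 2 * t + 2 * t * 5 ≡ 2 * (3 * (3 * t))
  regroup = solve-∀

lucas-+≈ : ∀ m b → lucas (m + b) ≈ 3 ^ m * lucas b
lucas-+≈ m b = begin
  lucas (m + b)          ≈⟨ lucas≈2*3^ (m + b) ⟩
  2 * 3 ^ (m + b)        ≡⟨ cong (2 *_) (^-distribˡ-+-* 3 m b) ⟩
  2 * (3 ^ m * 3 ^ b)    ≡⟨ x∙yz≈y∙xz 2 (3 ^ m) (3 ^ b) ⟩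
  3 ^ m * (2 * 3 ^ b)    ≈⟨ *-congˡ (3 ^ m) (≈-sym (lucas≈2*3^ b)) ⟩
  3 ^ m * lucas b        ∎

lucas≈1 : ∀ b → b % 4 ≡ 1 → lucas b ≈ 1
lucas≈1 b b%4≡1 = begin
  lucas b                ≡⟨ cong lucas b≡1+4q ⟩
  lucas (1 + 4 * q)      ≈⟨ lucas-+≈ 1 (4 * q) ⟩
  3 * lucas (4 * q)      ≈⟨ *-congˡ 3 (lucas≈2*3^ (4 * q)) ⟩
  3 * (2 * 3 ^ (4 * q))  ≈⟨ *-congˡ 3 (*-congˡ 2 (3^[4*m]≈1 q)) ⟩
  6                      ≈⟨ mod-p refl ⟩
  1                      ∎
  where
  q = b / 4
  b≡1+4q : b ≡ 1 + 4 * q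
  b≡1+4q = ≡.trans (m≡m%n+[m/n]*n b 4) (cong₂ _+_ b%4≡1 (*-comm q 4))

fib-5an+b≈[3^a]^n : ∀ a b n → fib b ≈ 1 → fib (5 * a * n + b) ≈ (3 ^ a) ^ n
fib-5an+b≈[3^a]^n a b n Fb≈1 = begin
  fib (5 * a * n + b)       ≡⟨ cong (λ m → fib (m + b)) (reorder a n) ⟩
  fib (a * n * 5 + b)       ≈⟨ fib-*5+ (a * n) b ⟩
  3 ^ (a * n) * fib b       ≈⟨ *-congˡ (3 ^ (a * n)) Fb≈1 ⟩
  3 ^ (a * n) * 1           ≡⟨ *-identityʳ (3 ^ (a * n)) ⟩
  3 ^ (a * n)               ≡⟨ ≡.sym (^-*-assoc 3 a n) ⟩
  (3 ^ a) ^ n               ∎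
  where
  reorder : ∀ a n → 5 * a * n ≡ a * n * 5
  reorder = solve-∀

lucas-an+b≈[3^a]^n : ∀ a b n → lucas b ≈ 1 → lucas (a * n + b) ≈ (3 ^ a) ^ n
lucas-an+b≈[3^a]^n a b n Lb≈1 = begin
  lucas (a * n + b)         ≈⟨ lucas-+≈ (a * n) b ⟩
  3 ^ (a * n) * lucas b     ≈⟨ *-congˡ (3 ^ (a * n)) Lb≈1 ⟩
  3 ^ (a * n) * 1           ≡⟨ *-identityʳ (3 ^ (a * n)) ⟩
  3 ^ (a * n)               ≡⟨ ≡.sym (^-*-assoc 3 a n) ⟩
  (3 ^ a) ^ n               ∎

corollary2 : (a b : ℕ) → 1 ≤ a → 1 ≤ b →
    ((b % 20 ≡ 1 ⊎ b % 20 ≡ 2 ⊎ b % 20 ≡ 8 ⊎ b % 20 ≡ 19) →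
       IsLP 5 (λ n → fib (5 * a * n + b)))
    × (b % 4 ≡ 1 → IsLP 5 (λ n → lucas (a * n + b)))
corollary2 a b _ _ =
    (λ b%20∈R → isLP-geometric ([3^a]^5≈3^a a) (λ n → fib-5an+b≈[3^a]^n a b n (fib≈1 b b%20∈R)))
  , (λ b%4≡1 → isLP-geometric ([3^a]^5≈3^a a) (λ n → lucas-an+b≈[3^a]^n a b n (lucas≈1 b b%4≡1)))
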